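{- Let $t$ be a positive integer divisible by $4$ and let $\mathcal{S}$ be a $\mathrm{BP}(t,4)$ on the point set $\mathbb{Z}_t$. For a parallel class $\mathcal{R}$ of $\mathcal{S}$ and $i \in \mathbb{Z}_8$ with binary representation $(j_2 j_3 j_4)$, let $\mathcal{R}_i$ be the set consisting, for each block $\{x_1,x_2,x_3,x_4\} \in \mathcal{R}$ with $x_1<x_2<x_3<x_4$, of the two blocks $$\{(x_1,0),(x_2,j_2),(x_3,j_3),(x_4,j_4)\},\quad \{(x_1,1),(x_2,j_2+1),(x_3,j_3+1),(x_4,j_4+1)\}$$ (second coordinates computed in $\mathbb{Z}_2$). Then each $\mathcal{R}_i$ is a parallel class on the point set $\mathbb{Z}_t \times \mathbb{Z}_2$ in which every block $\{(y_1,\ell_1),(y_2,\ell_2),(y_3,\ell_3),(y_4,\ell_4)\}$ satisfies $|\{y_1,y_2,y_3,y_4\}|=4$; any two such classes $\mathcal{R}_i$ and $\mathcal{R}'_j$ with $\mathcal{R}\neq\mathcal{R}'$ or $i \ne j$ are disjoint; and the number of such parallel classes obtained from all parallel classes of $\mathcal{S}$ is $8\binom{t-1}{3}$.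
   Context: A $\mathrm{BP}(n,4)$ on an $n$-set $V$ (with $4\mid n$) is a partition of all $4$-subsets of $V$ into parallel classes, a parallel class being a set of pairwise disjoint $4$-subsets whose union is $V$. -}

module Defs where

open import Data.Nat as ℕ using (ℕ)
open import Data.Fin as Fin using (Fin; zero; suc)
open import Data.Product using (Σ; _×_; _,_; proj₁)
open import Data.List as List using (List; []; _∷_; length; lookup; map; concat; concatMap)
open import Data.Vec as Vec using (Vec; []; _∷_)
open import Data.Vec.Membership.Propositional renaming (_∈_ to _∈ᵥ_)
open import Relation.Binary.PropositionalEquality using (_≡_)

-- A 4-subset {x₁,x₂,x₃,x₄} of Fin n, written canonically with x₁ < x₂ < x₃ < x₄.
record Quad (n : ℕ) : Set where
  constructor quad
  field
    x₁ x₂ x₃ x₄ : Fin n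
    x₁<x₂ : x₁ Fin.< x₂
    x₂<x₃ : x₂ Fin.< x₃
    x₃<x₄ : x₃ Fin.< x₄

elems : ∀ {n} → Quad n → Vec (Fin n) 4
elems q = Quad.x₁ q ∷ Quad.x₂ q ∷ Quad.x₃ q ∷ Quad.x₄ q ∷ []

Block : Set → Set
Block P = Vec P 4

Distinct4 : ∀ {P : Set} → Block P → Set
Distinct4 B = ∀ a b → Vec.lookup B a ≡ Vec.lookup B b → a ≡ b

ExactlyOne : ∀ {A : Set} → (xs : List A) → (A → Set) → Set
ExactlyOne xs Q =
  Σ (Fin (length xs)) λ k → Q (lookup xs k) × (∀ k′ → Q (lookup xs k′) → k′ ≡ k)

IsParallelClass : (P : Set) → List (Block P) → Set
IsParallelClass P R =
  (∀ k → Distinct4 (lookup R k)) × (∀ (p : P) → ExactlyOne R (λ B → p ∈ᵥ B))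

IsBP : (t : ℕ) → List (List (Quad t)) → Set
IsBP t S =
  (∀ k → IsParallelClass (Fin t) (map elems (lookup S k))) ×
  (∀ (q : Quad t) → ExactlyOne (concat S) (λ q′ → elems q′ ≡ elems q))

SameSet : ∀ {P : Set} → Block P → Block P → Set
SameSet B C = ∀ p → (p ∈ᵥ B → p ∈ᵥ C) × (p ∈ᵥ C → p ∈ᵥ B)

Disjoint : ∀ {P : Set} → List (Block P) → List (Block P) → Set
Disjoint R R′ = ∀ k k′ → SameSet (lookup R k) (lookup R′ k′) → Data.Empty.⊥
  where import Data.Empty

inc2 : Fin 2 → Fin 2
inc2 zero = suc zero
inc2 (suc zero) = zero

-- binary representation (j₂ j₃ j₄) of i ∈ Z_8, i = 4 j₂ + 2 j₃ + j₄
bits : Fin 8 → Fin 2 × Fin 2 × Fin 2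
bits i = b (Fin.toℕ i ℕ./ 4) , b ((Fin.toℕ i ℕ./ 2) ℕ.% 2) , b (Fin.toℕ i ℕ.% 2)
  where
  b : ℕ → Fin 2
  b 0 = zero
  b _ = suc zero

liftBlocks : ∀ {t} → Fin 8 → Quad t → List (Block (Fin t × Fin 2))
liftBlocks i q with bits i
... | j₂ , j₃ , j₄ =
  ((Quad.x₁ q , zero) ∷ (Quad.x₂ q , j₂) ∷ (Quad.x₃ q , j₃) ∷ (Quad.x₄ q , j₄) ∷ []) ∷
  ((Quad.x₁ q , suc zero) ∷ (Quad.x₂ q , inc2 j₂) ∷ (Quad.x₃ q , inc2 j₃) ∷ (Quad.x₄ q , inc2 j₄) ∷ []) ∷ []

lift : ∀ {t} → List (Quad t) → Fin 8 → List (Block (Fin t × Fin 2))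
lift R i = concatMap (liftBlocks i) R

allLifts : ∀ {t} → List (List (Quad t)) → List (List (Block (Fin t × Fin 2)))
allLifts S = concatMap (λ R → List.map (lift R) (List.allFin 8)) S

-- A lifted block is the zip of a sorted 4-subset of ℤ_t with a label vector in ℤ₂⁴, and
-- at each coordinate the two blocks over a given 4-subset carry complementary labels.
-- Hence a point (p , b) lies in exactly one block of 𝓡_i: the one over the block of 𝓡
-- through p whose label at p's coordinate is b. A lifted block, seen as a set, determines
-- its 4-subset (two increasing vectors with the same entries coincide) and its labels,
-- and the labels determine i; since a 4-subset lies in only one class of 𝓢, the classes
-- 𝓡_i are pairwise disjoint. Finally, sending a class of 𝓢 to its block through 0, that
-- is to a 3-subset of {1, …, t − 1}, is a bijection, so 𝓢 has C(t − 1, 3) classes.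

module Submission where

open import Defs
open import Data.Nat using (ℕ; _∸_; _*_; _<_)
open import Data.Nat.Divisibility using (_∣_)
open import Data.Nat.Combinatorics using (_C_)
open import Data.Fin using (Fin)
open import Data.Product using (_×_; proj₁)
open import Data.Sum using (_⊎_)
open import Data.List using (List; length; lookup)
open import Data.Vec as Vec using ()
open import Relation.Binary.PropositionalEquality using (_≡_; _≢_)

open import Data.Nat using (zero; suc; _+_; z<s; s<s; s<s⁻¹)
import Data.Nat.Properties as ℕ
open import Data.Nat.Combinatorics using (nCk+nC[k+1]≡[n+1]C[k+1])
open import Data.Fin as Fin using (zero; suc; toℕ; fromℕ<; combine)
open import Data.Fin.Patterns using (0F; 1F; 2F; 3F; 4F; 5F; 6F; 7F)
open import Data.Fin.Properties
  using (<-cmp; <-trans; <-irrefl; <-asym; toℕ<n; toℕ-fromℕ<; fromℕ<-toℕ; +↔⊎;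
         cantor-schröder-bernstein)
open import Data.Fin.Induction using (<-wellFounded)
open import Data.Product using (Σ; ∃!; _,_; proj₂)
open import Data.Sum using (inj₁; inj₂; [_,_]′)
import Data.Sum as Sum
open import Data.Sum.Function.Propositional using (_⊎-↔_)
open import Data.Unit using (⊤; tt)
open import Data.Empty using (⊥-elim)
open import Data.List using ([]; _∷_; map; concat; concatMap; _++_; allFin)
import Data.List.Properties as List
open import Data.Vec using (Vec; []; _∷_; zip)
open import Data.Vec.Properties using (lookup-zip; lookup-map; tabulate∘lookup; tabulate-cong)
open import Data.Vec.Relation.Unary.Any using (here; index)
open import Data.Vec.Relation.Unary.Any.Properties using (lookup-index)
open import Data.Vec.Relation.Unary.Linked using (Linked; [-]; _∷_)
open import Data.Vec.Relation.Unary.Linked.Properties using (lookup⁺)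
open import Data.Vec.Membership.Propositional using (_∈_)
open import Data.Vec.Membership.Propositional.Properties using (∈-lookup)
open import Function using (id; _∘_; _↔_; mk↔ₛ′; Inverse)
open import Function.Properties.Inverse using (↔-trans; ↔-sym; ↔⇒↣)
open import Function.Bundles using (Injection)
open import Induction.WellFounded using (module All)
open import Relation.Binary.Definitions using (tri<; tri≈; tri>)
open import Relation.Binary.PropositionalEquality
  using (refl; cong; cong₂; sym; trans; subst; subst₂; module ≡-Reasoning)
open import Relation.Nullary using (¬_)

module _ {B : Set} where

  ++-join : ∀ (xs ys : List B) → Fin (length xs) ⊎ Fin (length ys) → Fin (length (xs ++ ys))
  ++-join []       ys (inj₂ j)       = j
  ++-join (x ∷ xs) ys (inj₁ zero)    = zero
  ++-join (x ∷ xs) ys (inj₁ (suc i)) = suc (++-join xs ys (inj₁ i))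
  ++-join (x ∷ xs) ys (inj₂ j)       = suc (++-join xs ys (inj₂ j))

  ++-split : ∀ (xs ys : List B) → Fin (length (xs ++ ys)) → Fin (length xs) ⊎ Fin (length ys)
  ++-split []       ys j       = inj₂ j
  ++-split (x ∷ xs) ys zero    = inj₁ zero
  ++-split (x ∷ xs) ys (suc j) = Sum.map₁ suc (++-split xs ys j)

  ++-split-join : ∀ (xs ys : List B) s → ++-split xs ys (++-join xs ys s) ≡ s
  ++-split-join []       ys (inj₂ j)       = refl
  ++-split-join (x ∷ xs) ys (inj₁ zero)    = refl
  ++-split-join (x ∷ xs) ys (inj₁ (suc i)) = cong (Sum.map₁ suc) (++-split-join xs ys (inj₁ i))
  ++-split-join (x ∷ xs) ys (inj₂ j)       = cong (Sum.map₁ suc) (++-split-join xs ys (inj₂ j))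

  ++-join-split : ∀ (xs ys : List B) j → ++-join xs ys (++-split xs ys j) ≡ j
  ++-join-split []       ys j       = refl
  ++-join-split (x ∷ xs) ys zero    = refl
  ++-join-split (x ∷ xs) ys (suc j) = trans (join-suc (++-split xs ys j)) (cong suc (++-join-split xs ys j))
    where
    join-suc : ∀ s → ++-join (x ∷ xs) ys (Sum.map₁ suc s) ≡ suc (++-join xs ys s)
    join-suc (inj₁ i) = refl
    join-suc (inj₂ j) = refl

  lookup-++-join : ∀ (xs ys : List B) s →
                   lookup (xs ++ ys) (++-join xs ys s) ≡ [ lookup xs , lookup ys ]′ s
  lookup-++-join []       ys (inj₂ j)       = refl
  lookup-++-join (x ∷ xs) ys (inj₁ zero)    = refl
  lookup-++-join (x ∷ xs) ys (inj₁ (suc i)) = lookup-++-join xs ys (inj₁ i)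
  lookup-++-join (x ∷ xs) ys (inj₂ j)       = lookup-++-join xs ys (inj₂ j)

module _ {A B : Set} (f : A → List B) where

  Pos : List A → Set
  Pos xs = Σ (Fin (length xs)) λ k → Fin (length (f (lookup xs k)))

  lookupPos : ∀ xs → Pos xs → B
  lookupPos xs (k , e) = lookup (f (lookup xs k)) e

  private
    toIndex : ∀ xs → Pos xs → Fin (length (concatMap f xs))
    toIndex (x ∷ xs) (zero  , e) = ++-join (f x) _ (inj₁ e)
    toIndex (x ∷ xs) (suc k , e) = ++-join (f x) _ (inj₂ (toIndex xs (k , e)))

    fromIndex : ∀ xs → Fin (length (concatMap f xs)) → Pos xs
    fromIndex (x ∷ xs) j = [ (zero ,_) , (λ i → let (k , e) = fromIndex xs i in suc k , e) ]′
                             (++-split (f x) _ j)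

    from-to : ∀ xs p → fromIndex xs (toIndex xs p) ≡ p
    from-to (x ∷ xs) (zero , e) rewrite ++-split-join (f x) (concatMap f xs) (inj₁ e) = refl
    from-to (x ∷ xs) (suc k , e)
      rewrite ++-split-join (f x) (concatMap f xs) (inj₂ (toIndex xs (k , e))) | from-to xs (k , e) = refl

    to-from : ∀ xs j → toIndex xs (fromIndex xs j) ≡ j
    to-from (x ∷ xs) j with ++-split (f x) (concatMap f xs) j in eq
    ... | inj₁ e = trans (cong (++-join (f x) _) (sym eq)) (++-join-split (f x) _ j)
    ... | inj₂ i = trans (cong (λ i → ++-join (f x) _ (inj₂ i)) (to-from xs i))
                         (trans (cong (++-join (f x) _) (sym eq)) (++-join-split (f x) _ j))

  concatMap-index : ∀ xs → Pos xs ↔ Fin (length (concatMap f xs))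
  concatMap-index xs = mk↔ₛ′ (toIndex xs) (fromIndex xs) (to-from xs) (from-to xs)

  lookup-concatMap-index : ∀ xs p →
                           lookup (concatMap f xs) (Inverse.to (concatMap-index xs) p) ≡ lookupPos xs p
  lookup-concatMap-index (x ∷ xs) (zero  , e) = lookup-++-join (f x) _ (inj₁ e)
  lookup-concatMap-index (x ∷ xs) (suc k , e) =
    trans (lookup-++-join (f x) (concatMap f xs) (inj₂ _)) (lookup-concatMap-index xs (k , e))

  lookup-concatMap : ∀ xs j →
                     lookup (concatMap f xs) j ≡ lookupPos xs (Inverse.from (concatMap-index xs) j)
  lookup-concatMap xs j =
    trans (cong (lookup (concatMap f xs)) (sym (Inverse.strictlyInverseˡ (concatMap-index xs) j)))
          (lookup-concatMap-index xs _)

module _ {A B : Set} (g : A → B) where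

  private
    toIndex : ∀ xs → Fin (length xs) → Fin (length (map g xs))
    toIndex (x ∷ xs) zero    = zero
    toIndex (x ∷ xs) (suc k) = suc (toIndex xs k)

    fromIndex : ∀ xs → Fin (length (map g xs)) → Fin (length xs)
    fromIndex (x ∷ xs) zero    = zero
    fromIndex (x ∷ xs) (suc k) = suc (fromIndex xs k)

    from-to : ∀ xs k → fromIndex xs (toIndex xs k) ≡ k
    from-to (x ∷ xs) zero    = refl
    from-to (x ∷ xs) (suc k) = cong suc (from-to xs k)

    to-from : ∀ xs k → toIndex xs (fromIndex xs k) ≡ k
    to-from (x ∷ xs) zero    = refl
    to-from (x ∷ xs) (suc k) = cong suc (to-from xs k)

  map-index : ∀ xs → Fin (length xs) ↔ Fin (length (map g xs))
  map-index xs = mk↔ₛ′ (toIndex xs) (fromIndex xs) (to-from xs) (from-to xs)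

  lookup-map-index : ∀ xs k → lookup (map g xs) (Inverse.to (map-index xs) k) ≡ g (lookup xs k)
  lookup-map-index (x ∷ xs) zero    = refl
  lookup-map-index (x ∷ xs) (suc k) = lookup-map-index xs k

length-concatMap-const : ∀ {A B : Set} {f : A → List B} {c} → (∀ x → length (f x) ≡ c) →
                         ∀ xs → length (concatMap f xs) ≡ c * length xs
length-concatMap-const {c = c} lenf [] = sym (ℕ.*-zeroʳ c)
length-concatMap-const {f = f} {c} lenf (x ∷ xs) = begin
  length (f x ++ concatMap f xs)         ≡⟨ List.length-++ (f x) ⟩
  length (f x) + length (concatMap f xs) ≡⟨ cong₂ _+_ (lenf x) (length-concatMap-const lenf xs) ⟩
  c + c * length xs                      ≡⟨ ℕ.*-suc c (length xs) ⟨
  c * suc (length xs)                    ∎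
  where open ≡-Reasoning

module _ {I B : Set} {xs : List B} (ι : I ↔ Fin (length xs)) {g : I → B}
         (lookup-ι : ∀ i → lookup xs (Inverse.to ι i) ≡ g i) {Q : B → Set} where

  open Inverse ι

  private
    g-from : ∀ k → g (from k) ≡ lookup xs k
    g-from k = trans (sym (lookup-ι (from k))) (cong (lookup xs) (strictlyInverseˡ k))

  exactlyOne⇒∃! : ExactlyOne xs Q → ∃! _≡_ (Q ∘ g)
  exactlyOne⇒∃! (k , Qk , unique) =
    from k , subst Q (sym (g-from k)) Qk ,
    λ {i} Qi → trans (cong from (sym (unique (to i) (subst Q (sym (lookup-ι i)) Qi)))) (strictlyInverseʳ i)

  ∃!⇒exactlyOne : ∃! _≡_ (Q ∘ g) → ExactlyOne xs Q
  ∃!⇒exactlyOne (i , Qi , unique) =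
    to i , subst Q (sym (lookup-ι i)) Qi ,
    λ k Qk → trans (sym (strictlyInverseˡ k)) (cong to (sym (unique (subst Q (sym (g-from k)) Qk))))

∈⇒lookup : ∀ {A : Set} {n x} {u : Vec A n} → x ∈ u → Σ (Fin n) λ a → Vec.lookup u a ≡ x
∈⇒lookup x∈u = index x∈u , sym (lookup-index x∈u)

module _ {A : Set} where

  lookup-extensional : ∀ {n} {u w : Vec A n} → (∀ a → Vec.lookup u a ≡ Vec.lookup w a) → u ≡ w
  lookup-extensional {u = u} {w} eq =
    trans (sym (tabulate∘lookup u)) (trans (tabulate-cong eq) (tabulate∘lookup w))

  ∈-zip⁻ : ∀ {B : Set} {n x y} {u : Vec A n} {v : Vec B n} → (x , y) ∈ zip u v →
           Σ (Fin n) λ a → Vec.lookup u a ≡ x × Vec.lookup v a ≡ y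
  ∈-zip⁻ {u = u} {v} xy∈uv with ∈⇒lookup xy∈uv
  ... | a , eq = a , cong proj₁ eq′ , cong proj₂ eq′
    where eq′ = trans (sym (lookup-zip a u v)) eq

  ∈-zip⁺ : ∀ {B : Set} {n} (u : Vec A n) (v : Vec B n) a →
           (Vec.lookup u a , Vec.lookup v a) ∈ zip u v
  ∈-zip⁺ u v a = subst (_∈ zip u v) (lookup-zip a u v) (∈-lookup a (zip u v))

module _ {t n : ℕ} where

  Increasing : Vec (Fin t) n → Set
  Increasing = Linked Fin._<_

  increasing-lookup : ∀ {u} → Increasing u →
                      ∀ {a b} → a Fin.< b → Vec.lookup u a Fin.< Vec.lookup u b
  increasing-lookup u↑ = lookup⁺ <-trans u↑

  increasing-injective : ∀ {u} → Increasing u → ∀ {a b} → Vec.lookup u a ≡ Vec.lookup u b → a ≡ b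
  increasing-injective u↑ {a} {b} eq with <-cmp a b
  ... | tri< a<b _ _ = ⊥-elim (<-irrefl eq (increasing-lookup u↑ a<b))
  ... | tri≈ _ a≡b _ = a≡b
  ... | tri> _ _ b<a = ⊥-elim (<-irrefl (sym eq) (increasing-lookup u↑ b<a))

  private
    not-below : ∀ {u w} → Increasing u → Increasing w → ∀ {a} →
                (∀ {c} → c Fin.< a → Vec.lookup u c ≡ Vec.lookup w c) → Vec.lookup u a ∈ w →
                ¬ Vec.lookup u a Fin.< Vec.lookup w a
    not-below {u} {w} u↑ w↑ {a} agree ua∈w ua<wa with ∈⇒lookup ua∈w
    ... | b , wb≡ua with <-cmp a b
    ...   | tri< a<b _ _ =
      <-asym ua<wa (subst (Vec.lookup w a Fin.<_) wb≡ua (increasing-lookup w↑ a<b))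
    ...   | tri≈ _ refl _ = <-irrefl (sym wb≡ua) ua<wa
    ...   | tri> _ _ b<a = <-irrefl (trans (agree b<a) wb≡ua) (increasing-lookup u↑ b<a)

  -- Strong induction on positions: once u and w agree below a, the occurrence of u a in w
  -- cannot be before a, so w a ≤ u a; symmetrically u a ≤ w a.
  increasing-sameRange⇒≡ : ∀ {u w} → Increasing u → Increasing w →
                         (∀ a → Vec.lookup u a ∈ w) → (∀ a → Vec.lookup w a ∈ u) → u ≡ w
  increasing-sameRange⇒≡ {u} {w} u↑ w↑ u⊆w w⊆u = lookup-extensional (All.wfRec <-wellFounded _ _ step)
    where
    step : ∀ a → (∀ {c} → c Fin.< a → Vec.lookup u c ≡ Vec.lookup w c) →
           Vec.lookup u a ≡ Vec.lookup w a
    step a agree with <-cmp (Vec.lookup u a) (Vec.lookup w a)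
    ... | tri< ua<wa _ _ = ⊥-elim (not-below u↑ w↑ agree (u⊆w a) ua<wa)
    ... | tri≈ _ ua≡wa _ = ua≡wa
    ... | tri> _ _ wa<ua = ⊥-elim (not-below w↑ u↑ (sym ∘ agree) (w⊆u a) wa<ua)

zip-sameSet⇒≡ : ∀ {t} {B : Set} {u u′ : Vec (Fin t) 4} {ℓ ℓ′ : Vec B 4} →
                Increasing u → Increasing u′ → SameSet (zip u ℓ) (zip u′ ℓ′) → u ≡ u′ × ℓ ≡ ℓ′
zip-sameSet⇒≡ {t} {B} {u} {u′} {ℓ} {ℓ′} u↑ u′↑ same = u≡u′ , lookup-extensional ℓ≗ℓ′
  where
  firsts : ∀ {v v′ : Vec (Fin t) 4} {m m′ : Vec B 4} →
           (∀ p → p ∈ zip v m → p ∈ zip v′ m′) → ∀ a → Vec.lookup v a ∈ v′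
  firsts {v} {v′} {m} sub a with ∈-zip⁻ (sub _ (∈-zip⁺ v m a))
  ... | b , v′b≡ , _ = subst (_∈ v′) v′b≡ (∈-lookup b v′)
  u≡u′ : u ≡ u′
  u≡u′ = increasing-sameRange⇒≡ u↑ u′↑ (firsts (proj₁ ∘ same)) (firsts (proj₂ ∘ same))
  ℓ≗ℓ′ : ∀ a → Vec.lookup ℓ a ≡ Vec.lookup ℓ′ a
  ℓ≗ℓ′ a with ∈-zip⁻ (proj₁ (same _) (∈-zip⁺ u ℓ a))
  ... | b , u′b≡ua , ℓ′b≡ℓa
      with increasing-injective u↑ (trans (cong (λ v → Vec.lookup v b) u≡u′) u′b≡ua)
  ...   | refl = sym ℓ′b≡ℓa

module _ {t : ℕ} where

  elems-increasing : (q : Quad t) → Increasing (elems q)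
  elems-increasing (quad _ _ _ _ x₁<x₂ x₂<x₃ x₃<x₄) = x₁<x₂ ∷ x₂<x₃ ∷ x₃<x₄ ∷ [-]

  elems-injective : ∀ {q q′ : Quad t} → elems q ≡ elems q′ → q ≡ q′
  elems-injective {quad _ _ _ _ p₁ p₂ p₃} {quad _ _ _ _ p₁′ p₂′ p₃′} refl
    rewrite ℕ.<-irrelevant p₁ p₁′ | ℕ.<-irrelevant p₂ p₂′ | ℕ.<-irrelevant p₃ p₃′ = refl

zero∈elems⇒x₁≡zero : ∀ {n} (q : Quad (suc n)) → zero ∈ elems q → Quad.x₁ q ≡ zero
zero∈elems⇒x₁≡zero q 0∈q with ∈⇒lookup 0∈q
... | 0F    , x₁≡0 = x₁≡0
... | suc a , xₐ≡0 =
  ⊥-elim (ℕ.n≮0 (subst (Quad.x₁ q Fin.<_) xₐ≡0 (increasing-lookup (elems-increasing q) {0F} {suc a} z<s)))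

shift : Fin 2 → Fin 2 → Fin 2
shift 0F x = x
shift 1F x = inc2 x

shift-solve : ∀ x b → shift (shift x b) x ≡ b
shift-solve 0F 0F = refl
shift-solve 0F 1F = refl
shift-solve 1F 0F = refl
shift-solve 1F 1F = refl

shift-injectiveˡ : ∀ {e e′} x → shift e x ≡ shift e′ x → e ≡ e′
shift-injectiveˡ {0F} {0F} _  _ = refl
shift-injectiveˡ {1F} {1F} _  _ = refl
shift-injectiveˡ {0F} {1F} 0F ()
shift-injectiveˡ {0F} {1F} 1F ()
shift-injectiveˡ {1F} {0F} 0F ()
shift-injectiveˡ {1F} {0F} 1F ()

shift-injectiveʳ : ∀ e {x y} → shift e x ≡ shift e y → x ≡ y
shift-injectiveʳ 0F eq = eq
shift-injectiveʳ 1F {0F} {0F} _ = refl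
shift-injectiveʳ 1F {1F} {1F} _ = refl
shift-injectiveʳ 1F {0F} {1F} ()
shift-injectiveʳ 1F {1F} {0F} ()

unbits : Fin 2 × Fin 2 × Fin 2 → Fin 8
unbits (j₂ , j₃ , j₄) = combine j₂ (combine j₃ j₄)

unbits-bits : ∀ i → unbits (bits i) ≡ i
unbits-bits 0F = refl
unbits-bits 1F = refl
unbits-bits 2F = refl
unbits-bits 3F = refl
unbits-bits 4F = refl
unbits-bits 5F = refl
unbits-bits 6F = refl
unbits-bits 7F = refl

labels₀ : Fin 8 → Vec (Fin 2) 4
labels₀ i = 0F ∷ proj₁ (bits i) ∷ proj₁ (proj₂ (bits i)) ∷ proj₂ (proj₂ (bits i)) ∷ []

-- The second coordinates of the e-th block that liftBlocks i builds.
labels : Fin 8 → Fin 2 → Vec (Fin 2) 4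
labels i e = Vec.map (shift e) (labels₀ i)

labels-∃! : ∀ i a b → ∃! _≡_ (λ e → Vec.lookup (labels i e) a ≡ b)
labels-∃! i a b =
  shift x b , trans (lookup-at (shift x b)) (shift-solve x b) ,
  λ {e} eb → shift-injectiveˡ x (trans (shift-solve x b) (trans (sym eb) (lookup-at e)))
  where
  x = Vec.lookup (labels₀ i) a
  lookup-at : ∀ e → Vec.lookup (labels i e) a ≡ shift e x
  lookup-at e = lookup-map a (shift e) (labels₀ i)

labels-injective : ∀ {i j e e′} → labels i e ≡ labels j e′ → i ≡ j
labels-injective {i} {j} {e} {e′} eq with shift-injectiveˡ {e} {e′} 0F (cong Vec.head eq)
... | refl = trans (sym (unbits-bits i)) (trans (cong unbits bitsEq) (unbits-bits j))
  where
  bit : ∀ a → Vec.lookup (labels i e) (suc a) ≡ Vec.lookup (labels j e) (suc a)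
  bit a = cong (λ v → Vec.lookup v (suc a)) eq
  bitsEq : bits i ≡ bits j
  bitsEq = cong₂ _,_ (shift-injectiveʳ e (bit 0F))
             (cong₂ _,_ (shift-injectiveʳ e (bit 1F)) (shift-injectiveʳ e (bit 2F)))

module _ {t : ℕ} where

  liftBlock : Fin 8 → Quad t → Fin 2 → Block (Fin t × Fin 2)
  liftBlock i q e = zip (elems q) (labels i e)

  lookup-liftBlocks : ∀ i (q : Quad t) e → lookup (liftBlocks i q) e ≡ liftBlock i q e
  lookup-liftBlocks i q 0F = refl
  lookup-liftBlocks i q 1F = refl

  liftPos : ∀ (R : List (Quad t)) i → Fin (length (lift R i)) → Pos (liftBlocks i) R
  liftPos R i = Inverse.from (concatMap-index (liftBlocks i) R)

  lookup-lift : ∀ R i m → let (r , e) = liftPos R i m in lookup (lift R i) m ≡ liftBlock i (lookup R r) e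
  lookup-lift R i m =
    trans (lookup-concatMap (liftBlocks i) R m) (lookup-liftBlocks i (lookup R (proj₁ r)) (proj₂ r))
    where r = liftPos R i m

  liftBlock-proj₁ : ∀ i (q : Quad t) e a →
                    proj₁ (Vec.lookup (liftBlock i q e) a) ≡ Vec.lookup (elems q) a
  liftBlock-proj₁ i q e a = cong proj₁ (lookup-zip a (elems q) (labels i e))

  lift-distinctFirst : ∀ R i m a b → proj₁ (Vec.lookup (lookup (lift R i) m) a)
                                     ≡ proj₁ (Vec.lookup (lookup (lift R i) m) b) → a ≡ b
  lift-distinctFirst R i m a b eq =
    increasing-injective (elems-increasing q) (trans (sym (first a)) (trans eq (first b)))
    where
    r = liftPos R i m
    q = lookup R (proj₁ r)
    first : ∀ a → proj₁ (Vec.lookup (lookup (lift R i) m) a) ≡ Vec.lookup (elems q) a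
    first a = trans (cong (λ B → proj₁ (Vec.lookup B a)) (lookup-lift R i m)) (liftBlock-proj₁ i q (proj₂ r) a)

  liftBlock-sameSet⇒≡ : ∀ {i j} {q q′ : Quad t} {e e′} →
                        SameSet (liftBlock i q e) (liftBlock j q′ e′) → q ≡ q′ × i ≡ j
  liftBlock-sameSet⇒≡ {q = q} {q′} {e} {e′} same
    with zip-sameSet⇒≡ (elems-increasing q) (elems-increasing q′) same
  ... | elems≡ , labels≡ = elems-injective elems≡ , labels-injective {e = e} {e′} labels≡

  parallelClass-∃! : ∀ {R : List (Quad t)} → IsParallelClass (Fin t) (map elems R) →
                     ∀ p → ∃! _≡_ (λ r → p ∈ elems (lookup R r))
  parallelClass-∃! {R} (_ , cover) p =
    exactlyOne⇒∃! {xs = map elems R} (map-index elems R) (lookup-map-index elems R) {p ∈_} (cover p)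

  lift-∃! : ∀ {R : List (Quad t)} i → (∀ p → ∃! _≡_ (λ r → p ∈ elems (lookup R r))) →
            ∀ p b → ∃! _≡_ (λ ((r , e) : Pos (liftBlocks i) R) → (p , b) ∈ liftBlock i (lookup R r) e)
  lift-∃! {R} i cover p b with cover p
  ... | r , p∈r , r-unique with ∈⇒lookup p∈r
  ... | a , ra≡p with labels-∃! i a b
  ... | e , eb , e-unique = (r , e) , pb∈re , unique
    where
    pb∈re : (p , b) ∈ liftBlock i (lookup R r) e
    pb∈re = subst (_∈ liftBlock i (lookup R r) e) (cong₂ _,_ ra≡p eb)
                  (∈-zip⁺ (elems (lookup R r)) (labels i e) a)
    unique : ∀ {(r′ , e′) : Pos (liftBlocks i) R} →
             (p , b) ∈ liftBlock i (lookup R r′) e′ → (r , e) ≡ (r′ , e′)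
    unique {r′ , e′} pb∈ with ∈-zip⁻ pb∈
    ... | a′ , r′a′≡p , e′a′≡b
      with r-unique {r′} (subst (_∈ elems (lookup R r′)) r′a′≡p (∈-lookup a′ (elems (lookup R r′))))
    ... | refl with increasing-injective (elems-increasing (lookup R r)) {a′} {a} (trans r′a′≡p (sym ra≡p))
    ... | refl = cong (r ,_) (e-unique e′a′≡b)

  lift-isParallelClass : ∀ {R : List (Quad t)} i → IsParallelClass (Fin t) (map elems R) →
                         IsParallelClass (Fin t × Fin 2) (lift R i)
  lift-isParallelClass {R} i pc =
    (λ m a b eq → lift-distinctFirst R i m a b (cong proj₁ eq)) ,
    λ (p , b) → ∃!⇒exactlyOne {xs = lift R i} (concatMap-index (liftBlocks i) R) lookup-index-lift {(p , b) ∈_}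
                  (lift-∃! {R} i (parallelClass-∃! {R} pc) p b)
    where
    lookup-index-lift : ∀ ((r , e) : Pos (liftBlocks i) R) →
                        lookup (lift R i) (Inverse.to (concatMap-index (liftBlocks i) R) (r , e))
                        ≡ liftBlock i (lookup R r) e
    lookup-index-lift (r , e) =
      trans (lookup-concatMap-index (liftBlocks i) R (r , e)) (lookup-liftBlocks i (lookup R r) e)

-- k-subsets of {0, …, n − 1}, listed in decreasing order.
Combination : ℕ → ℕ → Set
Combination n zero    = ⊤
Combination n (suc k) = Σ ℕ λ c → c < n × Combination c k

-- Pascal's rule: either the largest element is n, or all elements are below n.
combination-pascal : ∀ n k → Combination (suc n) (suc k) ↔ (Combination n k ⊎ Combination n (suc k))
combination-pascal n k = mk↔ₛ′ split unsplit split-unsplit unsplit-split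
  where
  split : Combination (suc n) (suc k) → Combination n k ⊎ Combination n (suc k)
  split (c , c<1+n , s) with ℕ.m<1+n⇒m<n∨m≡n c<1+n
  ... | inj₁ c<n  = inj₂ (c , c<n , s)
  ... | inj₂ refl = inj₁ s
  unsplit : Combination n k ⊎ Combination n (suc k) → Combination (suc n) (suc k)
  unsplit (inj₁ s)             = n , ℕ.n<1+n n , s
  unsplit (inj₂ (c , c<n , s)) = c , ℕ.m<n⇒m<1+n c<n , s
  split-unsplit : ∀ s → split (unsplit s) ≡ s
  split-unsplit (inj₁ s) with ℕ.m<1+n⇒m<n∨m≡n (ℕ.n<1+n n)
  ... | inj₁ n<n = ⊥-elim (ℕ.<-irrefl refl n<n)
  ... | inj₂ n≡n rewrite ℕ.≡-irrelevant n≡n refl = refl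
  split-unsplit (inj₂ (c , c<n , s)) with ℕ.m<1+n⇒m<n∨m≡n (ℕ.m<n⇒m<1+n c<n)
  ... | inj₁ c<n′ rewrite ℕ.<-irrelevant c<n c<n′ = refl
  ... | inj₂ refl = ⊥-elim (ℕ.<-irrefl refl c<n)
  unsplit-split : ∀ s → unsplit (split s) ≡ s
  unsplit-split (c , c<1+n , s) with ℕ.m<1+n⇒m<n∨m≡n c<1+n
  ... | inj₁ c<n  rewrite ℕ.<-irrelevant (ℕ.m<n⇒m<1+n c<n) c<1+n = refl
  ... | inj₂ refl rewrite ℕ.<-irrelevant (ℕ.n<1+n c) c<1+n = refl

combination↔ : ∀ n k → Combination n k ↔ Fin (n C k)
combination↔ n       zero    = mk↔ₛ′ (λ _ → zero) (λ _ → tt) (λ { zero → refl }) (λ _ → refl)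
combination↔ zero    (suc k) = mk↔ₛ′ (λ { (_ , () , _) }) (λ ()) (λ ()) (λ { (_ , () , _) })
combination↔ (suc n) (suc k) =
  subst (λ m → Combination (suc n) (suc k) ↔ Fin m) (nCk+nC[k+1]≡[n+1]C[k+1] n k)
    (↔-trans (combination-pascal n k)
      (↔-trans (combination↔ n k ⊎-↔ combination↔ n (suc k)) (↔-sym +↔⊎)))

Fin-↔⇒≡ : ∀ {m n} → Fin m ↔ Fin n → m ≡ n
Fin-↔⇒≡ ι = cantor-schröder-bernstein (Injection.injective (↔⇒↣ ι)) (Injection.injective (↔⇒↣ (↔-sym ι)))

module _ {n : ℕ} where

  toCombination : Quad (suc n) → Combination n 3
  toCombination (quad _ 0F      _       _       () _  _)
  toCombination (quad _ (suc _) 0F      _       _  () _)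
  toCombination (quad _ (suc _) (suc _) 0F      _  _  ())
  toCombination (quad _ (suc y₂) (suc y₃) (suc y₄) _ y₂<y₃ y₃<y₄) =
    toℕ y₄ , toℕ<n y₄ , toℕ y₃ , s<s⁻¹ y₃<y₄ , toℕ y₂ , s<s⁻¹ y₂<y₃ , tt

  fromCombination : Combination n 3 → Quad (suc n)
  fromCombination (c , c<n , b , b<c , a , a<b , tt) =
    quad zero (suc (fromℕ< a<n)) (suc (fromℕ< b<n)) (suc (fromℕ< c<n))
         z<s (s<s (fromℕ<-< a<n b<n a<b)) (s<s (fromℕ<-< b<n c<n b<c))
    where
    b<n = ℕ.<-trans b<c c<n
    a<n = ℕ.<-trans a<b b<n
    fromℕ<-< : ∀ {x y} (x<n : x < n) (y<n : y < n) → x < y → fromℕ< x<n Fin.< fromℕ< y<n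
    fromℕ<-< x<n y<n = subst₂ _<_ (sym (toℕ-fromℕ< x<n)) (sym (toℕ-fromℕ< y<n))

  toCombination-fromCombination : ∀ s → toCombination (fromCombination s) ≡ s
  toCombination-fromCombination (c , c<n , b , b<c , a , a<b , tt) =
    combination₃-≡ (toℕ-fromℕ< c<n) (toℕ-fromℕ< b<n) (toℕ-fromℕ< (ℕ.<-trans a<b b<n))
    where
    b<n = ℕ.<-trans b<c c<n
    combination₃-≡ : ∀ {c c′ b b′ a a′} {p₁ : c < n} {p₁′ : c′ < n} {p₂ : b < c} {p₂′ : b′ < c′}
                       {p₃ : a < b} {p₃′ : a′ < b′} → c ≡ c′ → b ≡ b′ → a ≡ a′ →
                     _≡_ {A = Combination n 3} (c , p₁ , b , p₂ , a , p₃ , tt) (c′ , p₁′ , b′ , p₂′ , a′ , p₃′ , tt)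
    combination₃-≡ {p₁ = p₁} {p₁′} {p₂} {p₂′} {p₃} {p₃′} refl refl refl
      rewrite ℕ.<-irrelevant p₁ p₁′ | ℕ.<-irrelevant p₂ p₂′ | ℕ.<-irrelevant p₃ p₃′ = refl

  fromCombination-toCombination : ∀ q → Quad.x₁ q ≡ zero → fromCombination (toCombination q) ≡ q
  fromCombination-toCombination (quad _ 0F      _       _       () _  _)
  fromCombination-toCombination (quad _ (suc _) 0F      _       _  () _)
  fromCombination-toCombination (quad _ (suc _) (suc _) 0F      _  _  ())
  fromCombination-toCombination (quad _ (suc y₂) (suc y₃) (suc y₄) _ _ _) refl =
    elems-injective (cong₂ _∷_ refl (cong₂ _∷_ (back y₂) (cong₂ _∷_ (back y₃) (cong₂ _∷_ (back y₄) refl))))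
    where
    back : ∀ (y : Fin n) → suc (fromℕ< (toℕ<n y)) ≡ suc y
    back y = cong suc (fromℕ<-toℕ y (toℕ<n y))

module _ {t : ℕ} {S : List (List (Quad t))} (bp : IsBP t S) where

  position-∃! : ∀ q → ∃! _≡_ (λ ((k , m) : Pos id S) → elems (lookup (lookup S k) m) ≡ elems q)
  position-∃! q =
    exactlyOne⇒∃! {xs = concatMap id S} (concatMap-index id S) (lookup-concatMap-index id S) {SameElems}
      (subst (λ xs → ExactlyOne xs SameElems) (cong concat (sym (List.map-id S))) (proj₂ bp q))
    where
    SameElems : Quad t → Set
    SameElems q′ = elems q′ ≡ elems q

  sameBlock⇒sameClass : ∀ {k k′ m m′} → lookup (lookup S k) m ≡ lookup (lookup S k′) m′ → k ≡ k′
  sameBlock⇒sameClass {k} {k′} {m} {m′} eq with position-∃! (lookup (lookup S k) m)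
  ... | _ , _ , unique = cong proj₁ (trans (sym (unique {k , m} refl)) (unique {k′ , m′} (cong elems (sym eq))))

  classOf : Quad t → Fin (length S)
  classOf q = proj₁ (proj₁ (position-∃! q))

  ∈-classOf : ∀ q → Σ (Fin (length (lookup S (classOf q)))) λ m → lookup (lookup S (classOf q)) m ≡ q
  ∈-classOf q = proj₂ (proj₁ (position-∃! q)) , elems-injective (proj₁ (proj₂ (position-∃! q)))

  classOf-block : ∀ k m → classOf (lookup (lookup S k) m) ≡ k
  classOf-block k m = sameBlock⇒sameClass (proj₂ (∈-classOf (lookup (lookup S k) m)))

  lifts-disjoint : ∀ {k k′ i j} → k ≢ k′ ⊎ i ≢ j → Disjoint (lift (lookup S k) i) (lift (lookup S k′) j)
  lifts-disjoint {k} {k′} {i} {j} distinct m m′ same =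
    [ (λ k≢k′ → k≢k′ (sameBlock⇒sameClass (proj₁ shared))) , (λ i≢j → i≢j (proj₂ shared)) ]′ distinct
    where
    r  = liftPos (lookup S k) i m
    r′ = liftPos (lookup S k′) j m′
    shared : lookup (lookup S k) (proj₁ r) ≡ lookup (lookup S k′) (proj₁ r′) × i ≡ j
    shared = liftBlock-sameSet⇒≡ {e = proj₂ r} {proj₂ r′}
               (subst₂ SameSet (lookup-lift (lookup S k) i m) (lookup-lift (lookup S k′) j m′) same)

module _ {n : ℕ} {S : List (List (Quad (suc n)))} (bp : IsBP (suc n) S) where

  private
    zero-∃! : ∀ k → ∃! _≡_ (λ m → zero ∈ elems (lookup (lookup S k) m))
    zero-∃! k = parallelClass-∃! {R = lookup S k} (proj₁ bp k) zero

    classOf′ : Quad (suc n) → Fin (length S)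
    classOf′ = classOf {S = S} bp

  zeroBlock : Fin (length S) → Quad (suc n)
  zeroBlock k = lookup (lookup S k) (proj₁ (zero-∃! k))

  classes↔combinations : Fin (length S) ↔ Combination n 3
  classes↔combinations = mk↔ₛ′ (toCombination ∘ zeroBlock) (classOf′ ∘ fromCombination) to-from from-to
    where
    from-to : ∀ k → classOf′ (fromCombination (toCombination (zeroBlock k))) ≡ k
    from-to k = trans (cong classOf′ (fromCombination-toCombination (zeroBlock k) x₁≡0))
                      (classOf-block {S = S} bp k _)
      where
      x₁≡0 = zero∈elems⇒x₁≡zero (zeroBlock k) (proj₁ (proj₂ (zero-∃! k)))
    to-from : ∀ c → toCombination (zeroBlock (classOf′ (fromCombination c))) ≡ c
    to-from c = trans (cong toCombination zeroBlock≡) (toCombination-fromCombination c)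
      where
      q = fromCombination c
      k = classOf′ q
      m = proj₁ (∈-classOf {S = S} bp q)
      block≡ : lookup (lookup S k) m ≡ q
      block≡ = proj₂ (∈-classOf {S = S} bp q)
      zeroBlock≡ : zeroBlock k ≡ q
      zeroBlock≡ = trans (cong (lookup (lookup S k)) (proj₂ (proj₂ (zero-∃! k)) 0∈block)) block≡
        where 0∈block = subst (λ q → zero ∈ elems q) (sym block≡) (here refl)

  length-classes : length S ≡ n C 3
  length-classes = Fin-↔⇒≡ (↔-trans classes↔combinations (combination↔ n 3))

lemma1 : (t : ℕ) → 0 < t → 4 ∣ t → (S : List (List (Quad t))) → IsBP t S →
    ((k : Fin (length S)) (i : Fin 8) →
        IsParallelClass (Fin t × Fin 2) (lift (lookup S k) i)
        × (∀ m a b → proj₁ (Vec.lookup (lookup (lift (lookup S k) i) m) a)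
                      ≡ proj₁ (Vec.lookup (lookup (lift (lookup S k) i) m) b) → a ≡ b))
    × ((k k′ : Fin (length S)) (i j : Fin 8) → k ≢ k′ ⊎ i ≢ j →
        Disjoint (lift (lookup S k) i) (lift (lookup S k′) j))
    × length (allLifts S) ≡ 8 * ((t ∸ 1) C 3)
lemma1 (suc n) _ _ S bp =
  (λ k i → lift-isParallelClass {R = lookup S k} i (proj₁ bp k) , lift-distinctFirst (lookup S k) i) ,
  (λ k k′ i j → lifts-disjoint {S = S} bp) ,
  trans (length-concatMap-const {f = λ R → map (lift R) (allFin 8)} (λ _ → refl) S)
        (cong (8 *_) (length-classes {S = S} bp))
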